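{- Let $n$ be a power of $2$ and $m$ a positive integer, and consider the variables $P_{i,k}$ ($i\in[m]$, $k\in[\log n]$) of the binary $\mathrm{PHP}^m_n$. Let $\mathcal R'$ be the random restriction that, independently for each pigeon $i$, chooses a bit $k\in[\log n]$ uniformly at random and sets $P_{i,k}$ to $0$ or $1$ with probability $1/2$ each. Then a term $T$ (a conjunction of literals $P_{i,k}^{b}$) that mentions $n'$ pigeons does not evaluate to zero under $\mathcal R'$ with probability at most $e^{ -n'/(2\log n)}$.
   Context: $P^1=P$, $P^0=\neg P$. A term $T=\bigwedge_j P^{b_j}_{i_j,k_j}$ mentions the set of pigeons $\{i_j\}$. $T$ evaluates to zero under a restriction if the restriction falsifies at least one literal of $T$. -}

module Defs where

open import Data.Bool.ListAction using (any)
open import Data.Bool using (Bool; true; false; _∧_; not; if_then_else_)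
open import Data.Bool.Properties using () renaming (_≟_ to _≟B_)
open import Data.Nat using (ℕ; zero; suc; _*_; _^_; NonZero; _!)
open import Data.Nat.Properties using (m^n≢0; _!≢0; m*n≢0)
open import Data.Fin using (Fin)
open import Data.Fin.Properties using () renaming (_≟_ to _≟F_)
open import Data.Product using (_×_; _,_; proj₁; proj₂)
open import Data.List using (List; []; _∷_; map; concatMap; length; deduplicate; allFin; cartesianProduct)
open import Data.Vec using (Vec; lookup) renaming ([] to []ᵥ; _∷_ to _∷ᵥ_)
open import Data.Integer using (+_)
open import Data.Rational using (ℚ; _/_; _≤_; 1ℚ) renaming (_+_ to _+ℚ_; _*_ to _*ℚ_)
open import Relation.Nullary.Decidable using (isYes)

-- Binary PHP^m_n with log n = L : variables P_{i,k}, i ∈ [m], k ∈ [L].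
-- A literal P^b_{i,k} (P^1 = P, P^0 = ¬P) is the triple (i , k , b).
Literal : ℕ → ℕ → Set
Literal m L = Fin m × Fin L × Bool

Term : ℕ → ℕ → Set
Term m L = List (Literal m L)

pigeonsMentioned : ∀ {m L} → Term m L → ℕ
pigeonsMentioned T = length (deduplicate _≟F_ (map proj₁ T))

-- An outcome of R': for every pigeon i, the chosen bit k and the value
-- assigned to P_{i,k}.
Restriction : ℕ → ℕ → Set
Restriction m L = Vec (Fin L × Bool) m

falsifies : ∀ {m L} → Restriction m L → Literal m L → Bool
falsifies ρ (i , k , b) with lookup ρ i
... | (k' , v) = isYes (k' ≟F k) ∧ not (isYes (v ≟B b))

evalsToZero : ∀ {m L} → Restriction m L → Term m L → Bool
evalsToZero ρ T = any (falsifies ρ) T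

choices : (L : ℕ) → List (Fin L × Bool)
choices L = cartesianProduct (allFin L) (true ∷ false ∷ [])

allRestrictions : (m L : ℕ) → List (Restriction m L)
allRestrictions zero L = []ᵥ ∷ []
allRestrictions (suc m) L =
  concatMap (λ c → map (c ∷ᵥ_) (allRestrictions m L)) (choices L)

countTrue : ∀ {A : Set} → (A → Bool) → List A → ℕ
countTrue p [] = 0
countTrue p (x ∷ xs) = if p x then suc (countTrue p xs) else countTrue p xs

-- Pr_{ρ ~ R'} [ T does not evaluate to zero under ρ ]
-- = #{ρ : T not zero under ρ} / (2L)^m  (uniform distribution).
probNotZero : (m L : ℕ) .{{_ : NonZero L}} → Term m L → ℚ
probNotZero m L T =
  _/_ (+ countTrue (λ ρ → not (evalsToZero ρ T)) (allRestrictions m L))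
      ((2 * L) ^ m) {{m^n≢0 (2 * L) m {{m*n≢0 2 L}}}}

powℚ : ℚ → ℕ → ℚ
powℚ y zero = 1ℚ
powℚ y (suc k) = y *ℚ powℚ y k

expPartial : ℚ → ℕ → ℚ
expPartial y zero = 1ℚ
expPartial y (suc N) =
  expPartial y N +ℚ powℚ y (suc N) *ℚ _/_ (+ 1) (suc N !) {{suc N !≢0}}

-- For y ≥ 0:  p ≤ e^{-y}  ⇔  p · e^y ≤ 1  ⇔  p · Σ_{k≤N} y^k/k! ≤ 1 for all N
-- (e^y is the supremum of its increasing partial sums).
_≤exp-_ : ℚ → ℚ → Set
p ≤exp- y = ∀ (N : ℕ) → p *ℚ expPartial y N ≤ 1ℚ

-- Pigeons choose independently, and for every pigeon mentioned by T one of its 2L equally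
-- likely choices falsifies a literal of T on it; hence, with q = 2L, at most a fraction
-- (1 - 1/q)^n' of the outcomes leave T alive.  That (1 - 1/q)^u ≤ e^{-u/q} is shown in the
-- form (1 - 1/q)^u · e_N(u/q) ≤ 1 for the partial sums e_N(x) = Σ_{k≤N} x^k/k!, by induction
-- on u from the discrete derivative bound e_N(x + 1/q) ≤ e_N(x) + e_N(x + 1/q)/q.
-- Everything is done in ℕ after clearing the denominators q^m and q^N·N!.
module Submission where

open import Defs
open import Data.Nat using (ℕ; _^_; _*_; _≤_; NonZero)
open import Data.Nat.Properties using (m*n≢0)
open import Data.Integer using (+_)
open import Data.Rational using (_/_)
open import Relation.Binary.PropositionalEquality using (_≡_)

open import Data.Bool using (Bool; true; false; _∧_; _∨_; not; if_then_else_)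
open import Data.Bool.Properties using (∧-zeroʳ; ∨-zeroʳ; ∧-conicalˡ) renaming (_≟_ to _≟B_)
open import Data.Fin using (Fin; zero; suc)
open import Data.Fin.Properties using () renaming (_≟_ to _≟F_)
import Data.Integer as ℤ
import Data.Integer.Properties as ℤ
open import Data.List using (List; []; _∷_; _++_; map; concatMap; length; allFin; tabulate; cartesianProduct)
open import Data.List.Membership.Propositional using (_∈_)
open import Data.List.Membership.Propositional.Properties using (∈-allFin; ∈-cartesianProduct⁺)
open import Data.List.Properties using (length-tabulate; map-tabulate)
open import Data.List.Relation.Unary.All as All using (All; []; _∷_)
open import Data.List.Relation.Unary.All.Properties using (deduplicate⁺)
open import Data.List.Relation.Unary.AllPairs using ([]; _∷_)
open import Data.List.Relation.Unary.Any using (here; there)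
open import Data.List.Relation.Unary.Unique.Propositional using (Unique)
import Data.List.Relation.Unary.Unique.DecPropositional.Properties as Unique
open import Data.Nat using (zero; suc; _+_; _<_; z≤n; s≤s; pred; _!)
open import Data.Nat.Properties
open import Algebra.Properties.CommutativeSemigroup *-commutativeSemigroup
  using (x∙yz≈xz∙y; xy∙z≈xz∙y; xy∙z≈zy∙x; x∙yz≈y∙xz; xy∙z≈y∙xz)
open import Data.Nat.Tactic.RingSolver using (solve-∀)
open import Data.Product using (_×_; _,_; proj₁; ∃)
open import Data.Rational as ℚ using (1ℚ; toℚᵘ) renaming (_+_ to _+ℚ_; _*_ to _*ℚ_)
import Data.Rational.Properties as ℚ
open import Data.Rational.Unnormalised as ℚᵘ using (ℚᵘ; 1ℚᵘ; *≡*; *≤*; _≃_) renaming (_/_ to _/ᵘ_)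
import Data.Rational.Unnormalised.Properties as ℚᵘ
open import Data.Vec using () renaming ([] to []ᵥ; _∷_ to _∷ᵥ_)
open import Function using (_∘_; id)
open import Relation.Binary.PropositionalEquality using (_≢_; refl; sym; trans; cong; cong₂; subst; subst₂; module ≡-Reasoning)
open import Relation.Nullary using (yes; no; contradiction)
open import Relation.Nullary.Decidable using (isYes; isYes≗does; dec-true)

module _ {A : Set} where

  countTrue-++ : ∀ (p : A → Bool) xs ys → countTrue p (xs ++ ys) ≡ countTrue p xs + countTrue p ys
  countTrue-++ p []       ys = refl
  countTrue-++ p (x ∷ xs) ys with p x
  ... | true  = cong suc (countTrue-++ p xs ys)
  ... | false = countTrue-++ p xs ys

  countTrue-cong : ∀ {p p′ : A → Bool} → (∀ x → p x ≡ p′ x) → ∀ xs → countTrue p xs ≡ countTrue p′ xs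
  countTrue-cong             eq []       = refl
  countTrue-cong {p′ = p′} eq (x ∷ xs) rewrite eq x with p′ x
  ... | true  = cong suc (countTrue-cong eq xs)
  ... | false = countTrue-cong eq xs

  countTrue-false : ∀ (xs : List A) → countTrue (λ _ → false) xs ≡ 0
  countTrue-false []       = refl
  countTrue-false (x ∷ xs) = countTrue-false xs

  countTrue-true : ∀ (xs : List A) → countTrue (λ _ → true) xs ≡ length xs
  countTrue-true []       = refl
  countTrue-true (x ∷ xs) = cong suc (countTrue-true xs)

  module _ {p p′ : A → Bool} (p⇒p′ : ∀ x → p x ≡ true → p′ x ≡ true) where

    countTrue-mono-≤ : ∀ xs → countTrue p xs ≤ countTrue p′ xs
    countTrue-mono-≤ []       = z≤n
    countTrue-mono-≤ (x ∷ xs) with p x in px | p′ x in p′x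
    ... | true  | true  = s≤s (countTrue-mono-≤ xs)
    ... | true  | false = contradiction (trans (sym (p⇒p′ x px)) p′x) λ ()
    ... | false | true  = m≤n⇒m≤1+n (countTrue-mono-≤ xs)
    ... | false | false = countTrue-mono-≤ xs

    countTrue-mono-< : ∀ {y} xs → y ∈ xs → p y ≡ false → p′ y ≡ true → countTrue p xs < countTrue p′ xs
    countTrue-mono-< (x ∷ xs) (here refl)  py p′y rewrite py | p′y = s≤s (countTrue-mono-≤ xs)
    countTrue-mono-< (x ∷ xs) (there y∈xs) py p′y with p x in px | p′ x in p′x
    ... | true  | true  = s≤s (countTrue-mono-< xs y∈xs py p′y)
    ... | true  | false = contradiction (trans (sym (p⇒p′ x px)) p′x) λ ()
    ... | false | true  = m≤n⇒m≤1+n (countTrue-mono-< xs y∈xs py p′y)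
    ... | false | false = countTrue-mono-< xs y∈xs py p′y

countTrue-map : ∀ {A B : Set} (p : B → Bool) (f : A → B) xs → countTrue p (map f xs) ≡ countTrue (p ∘ f) xs
countTrue-map p f []       = refl
countTrue-map p f (x ∷ xs) with p (f x)
... | true  = cong suc (countTrue-map p f xs)
... | false = countTrue-map p f xs

countTrue-concatMap : ∀ {A B C : Set} (f : A → B → C) (p : C → Bool) (a : A → Bool) (b : B → Bool) →
  (∀ x y → p (f x y) ≡ a x ∧ b y) →
  ∀ xs ys → countTrue p (concatMap (λ x → map (f x) ys) xs) ≡ countTrue a xs * countTrue b ys
countTrue-concatMap f p a b split []       ys = refl
countTrue-concatMap f p a b split (x ∷ xs) ys = begin
    countTrue p (map (f x) ys ++ rest)
  ≡⟨ countTrue-++ p (map (f x) ys) rest ⟩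
    countTrue p (map (f x) ys) + countTrue p rest
  ≡⟨ cong₂ _+_ (trans (countTrue-map p (f x) ys) (countTrue-cong (split x) ys))
               (countTrue-concatMap f p a b split xs ys) ⟩
    countTrue (λ y → a x ∧ b y) ys + countTrue a xs * countTrue b ys
  ≡⟨ row (a x) ⟩
    countTrue a (x ∷ xs) * countTrue b ys
  ∎
  where
  open ≡-Reasoning
  rest = concatMap (λ x → map (f x) ys) xs
  row : ∀ c → countTrue (λ y → c ∧ b y) ys + countTrue a xs * countTrue b ys
            ≡ (if c then suc (countTrue a xs) else countTrue a xs) * countTrue b ys
  row true  = refl
  row false = cong (_+ countTrue a xs * countTrue b ys) (countTrue-false ys)

isYes-refl : ∀ {n} (i : Fin n) → isYes (i ≟F i) ≡ true
isYes-refl i = trans (isYes≗does (i ≟F i)) (dec-true (i ≟F i) refl)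

unique⇒length≤countTrue : ∀ {n} (p : Fin n → Bool) (xs : List (Fin n)) → Unique xs →
  All (λ x → p x ≡ true) xs → length xs ≤ countTrue p (allFin n)
unique⇒length≤countTrue p []       _            _          = z≤n
unique⇒length≤countTrue {n} p (x ∷ xs) (x∉xs ∷ xs!) (px ∷ pxs) = begin-strict
    length xs                ≤⟨ unique⇒length≤countTrue p-x xs xs! (All.zipWith p-x-holds (x∉xs , pxs)) ⟩
    countTrue p-x (allFin n) <⟨ countTrue-mono-< (λ y → ∧-conicalˡ (p y) _) (allFin n) (∈-allFin x) p-x-fails px ⟩
    countTrue p (allFin n)   ∎
  where
  open ≤-Reasoning
  p-x : Fin n → Bool
  p-x y = p y ∧ not (isYes (y ≟F x))
  p-x-fails : p-x x ≡ false
  p-x-fails rewrite isYes-refl x = ∧-zeroʳ (p x)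
  p-x-holds : ∀ {y} → x ≢ y × p y ≡ true → p-x y ≡ true
  p-x-holds {y} (x≢y , py) with y ≟F x
  ... | yes y≡x = contradiction (sym y≡x) x≢y
  ... | no  _   rewrite py = refl

-- a/b ≤ c/d ≤ e/f, cross-multiplied.
cross-≤-trans : ∀ {a b c d e f} .{{_ : NonZero d}} → a * d ≤ b * c → c * f ≤ d * e → a * f ≤ b * e
cross-≤-trans {a} {b} {c} {d} {e} {f} ad≤bc cf≤de = *-cancelʳ-≤ (a * f) (b * e) d (begin
  a * f * d   ≡⟨ xy∙z≈xz∙y a f d ⟩
  a * d * f   ≤⟨ *-monoˡ-≤ f ad≤bc ⟩
  b * c * f   ≡⟨ *-assoc b c f ⟩
  b * (c * f) ≤⟨ *-monoʳ-≤ b cf≤de ⟩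
  b * (d * e) ≡⟨ x∙yz≈xz∙y b d e ⟩
  b * e * d   ∎)
  where open ≤-Reasoning

pow-ratio-antimono : ∀ {r q k K} → r ≤ q → k ≤ K → r ^ K * q ^ k ≤ q ^ K * r ^ k
pow-ratio-antimono {r} {q} {k} r≤q k≤K with j , refl ← m≤n⇒∃[o]m+o≡n k≤K = begin
  r ^ (k + j) * q ^ k   ≡⟨ cong (_* q ^ k) (^-distribˡ-+-* r k j) ⟩
  r ^ k * r ^ j * q ^ k ≤⟨ *-monoˡ-≤ (q ^ k) (*-monoʳ-≤ (r ^ k) (^-monoˡ-≤ j r≤q)) ⟩
  r ^ k * q ^ j * q ^ k ≡⟨ xy∙z≈zy∙x (r ^ k) (q ^ j) (q ^ k) ⟩
  q ^ k * q ^ j * r ^ k ≡⟨ cong (_* r ^ k) (^-distribˡ-+-* q k j) ⟨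
  q ^ (k + j) * r ^ k   ∎
  where open ≤-Reasoning

-- expScaled q N u = q^N · N! · e_N(u/q), the numerator of expPartial (u/q) N over q^N · N!.
expScaled : ℕ → ℕ → ℕ → ℕ
expScaled q zero    u = 1
expScaled q (suc N) u = q * suc N * expScaled q N u + u ^ suc N

suc-^-≤ : ∀ u j → suc u ^ suc j ≤ u ^ suc j + suc j * suc u ^ j
suc-^-≤ u zero = ≤-reflexive (identity u)
  where
  identity : ∀ u → suc u * 1 ≡ u * 1 + 1 * 1
  identity = solve-∀
suc-^-≤ u (suc j) = begin
    suc u * suc u ^ suc j
  ≤⟨ *-monoʳ-≤ (suc u) (suc-^-≤ u j) ⟩
    suc u * (u ^ suc j + suc j * suc u ^ j)
  ≡⟨ expand u (u ^ suc j) (suc u ^ j) j ⟩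
    u * u ^ suc j + u ^ suc j + suc j * (suc u * suc u ^ j)
  ≤⟨ +-monoˡ-≤ _ (+-monoʳ-≤ (u * u ^ suc j) (^-monoˡ-≤ (suc j) (n≤1+n u))) ⟩
    u * u ^ suc j + suc u ^ suc j + suc j * (suc u * suc u ^ j)
  ≡⟨ +-assoc (u * u ^ suc j) _ _ ⟩
    u * u ^ suc j + suc (suc j) * suc u ^ suc j
  ∎
  where
  open ≤-Reasoning
  expand : ∀ u X Z j → suc u * (X + suc j * Z) ≡ u * X + X + suc j * (suc u * Z)
  expand = solve-∀

module _ (q : ℕ) where

  expScaled-suc-≤ : ∀ N u →
    expScaled q (suc N) (suc u) ≤ expScaled q (suc N) u + suc N * expScaled q N (suc u)
  expScaled-suc-≤ zero u = ≤-reflexive (identity q u)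
    where
    identity : ∀ q u → q * 1 * 1 + suc u * 1 ≡ q * 1 * 1 + u * 1 + 1 * 1
    identity = solve-∀
  expScaled-suc-≤ (suc N) u = begin
      q * suc (suc N) * expScaled q (suc N) (suc u) + suc u ^ suc (suc N)
    ≤⟨ +-mono-≤ (*-monoʳ-≤ (q * suc (suc N)) (expScaled-suc-≤ N u)) (suc-^-≤ u (suc N)) ⟩
      q * suc (suc N) * (expScaled q (suc N) u + suc N * expScaled q N (suc u))
        + (u ^ suc (suc N) + suc (suc N) * suc u ^ suc N)
    ≡⟨ regroup q N (expScaled q (suc N) u) (expScaled q N (suc u)) (u ^ suc (suc N)) (suc u ^ suc N) ⟩
      q * suc (suc N) * expScaled q (suc N) u + u ^ suc (suc N)
        + suc (suc N) * (q * suc N * expScaled q N (suc u) + suc u ^ suc N)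
    ∎
    where
    open ≤-Reasoning
    regroup : ∀ q N a b X Y → q * suc (suc N) * (a + suc N * b) + (X + suc (suc N) * Y)
              ≡ q * suc (suc N) * a + X + suc (suc N) * (q * suc N * b + Y)
    regroup = solve-∀

  expScaled-at-0 : ∀ N → expScaled q N 0 ≡ q ^ N * N !
  expScaled-at-0 zero    = refl
  expScaled-at-0 (suc N) = trans (cong (λ e → q * suc N * e + 0) (expScaled-at-0 N)) (identity q N (q ^ N) (N !))
    where
    identity : ∀ q N p f → q * suc N * (p * f) + 0 ≡ q * p * (f + N * f)
    identity = solve-∀

module _ (r : ℕ) where

  -- (1 - 1/q) e_N(x + 1/q) ≤ e_N(x), for q = r + 1.
  expScaled-shift : ∀ N u → r * expScaled (suc r) N (suc u) ≤ suc r * expScaled (suc r) N u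
  expScaled-shift zero    u = *-monoˡ-≤ 1 (n≤1+n r)
  expScaled-shift (suc N) u = +-cancelʳ-≤ X (r * X) (suc r * E) (begin
      r * X + X                       ≡⟨ +-comm (r * X) X ⟩
      suc r * X                       ≤⟨ *-monoʳ-≤ (suc r) (expScaled-suc-≤ (suc r) N u) ⟩
      suc r * (E + suc N * Y)         ≡⟨ *-distribˡ-+ (suc r) E (suc N * Y) ⟩
      suc r * E + suc r * (suc N * Y) ≡⟨ cong (_+_ (suc r * E)) (*-assoc (suc r) (suc N) Y) ⟨
      suc r * E + suc r * suc N * Y   ≤⟨ +-monoʳ-≤ (suc r * E) (m≤m+n (suc r * suc N * Y) (suc u ^ suc N)) ⟩
      suc r * E + X                   ∎)
    where
    open ≤-Reasoning
    X = expScaled (suc r) (suc N) (suc u)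
    E = expScaled (suc r) (suc N) u
    Y = expScaled (suc r) N (suc u)

  expScaled-bound : ∀ N k → r ^ k * expScaled (suc r) N k ≤ suc r ^ k * (suc r ^ N * N !)
  expScaled-bound N zero =
    ≤-reflexive (trans (+-identityʳ _) (trans (expScaled-at-0 (suc r) N) (sym (+-identityʳ _))))
  expScaled-bound N (suc k) = begin
      r * r ^ k * expScaled (suc r) N (suc k)     ≡⟨ xy∙z≈y∙xz r (r ^ k) _ ⟩
      r ^ k * (r * expScaled (suc r) N (suc k))   ≤⟨ *-monoʳ-≤ (r ^ k) (expScaled-shift N k) ⟩
      r ^ k * (suc r * expScaled (suc r) N k)     ≡⟨ x∙yz≈y∙xz (r ^ k) (suc r) _ ⟩
      suc r * (r ^ k * expScaled (suc r) N k)     ≤⟨ *-monoʳ-≤ (suc r) (expScaled-bound N k) ⟩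
      suc r * (suc r ^ k * (suc r ^ N * N !))     ≡⟨ *-assoc (suc r) (suc r ^ k) (suc r ^ N * N !) ⟨
      suc r * suc r ^ k * (suc r ^ N * N !)       ∎
    where open ≤-Reasoning

infix 7.5 _÷_

_÷_ : ℕ → (d : ℕ) → .{{NonZero d}} → ℚᵘ
a ÷ d = + a /ᵘ d

module _ {a b : ℕ} where

  ÷-≃ : ∀ d e .{{_ : NonZero d}} .{{_ : NonZero e}} → a * e ≡ b * d → a ÷ d ≃ b ÷ e
  ÷-≃ (suc d) (suc e) eq =
    *≡* (trans (sym (ℤ.pos-* a (suc e))) (trans (cong +_ eq) (ℤ.pos-* b (suc d))))

  ÷-* : ∀ d e .{{_ : NonZero d}} .{{_ : NonZero e}} →
        a ÷ d ℚᵘ.* b ÷ e ≃ ((a * b) ÷ (d * e)) {{m*n≢0 d e}}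
  ÷-* (suc d) (suc e) = ℚᵘ.≃-reflexive (ℚᵘ.↥↧≡⇒≡ (sym (ℤ.pos-* a b)) refl)

  ÷-+ : ∀ d e .{{_ : NonZero d}} .{{_ : NonZero e}} →
        a ÷ d ℚᵘ.+ b ÷ e ≃ ((a * e + b * d) ÷ (d * e)) {{m*n≢0 d e}}
  ÷-+ (suc d) (suc e) = ℚᵘ.≃-reflexive (ℚᵘ.↥↧≡⇒≡ (sym numerator) refl)
    where
    numerator : + (a * suc e + b * suc d) ≡ + a ℤ.* + suc e ℤ.+ + b ℤ.* + suc d
    numerator = trans (ℤ.pos-+ (a * suc e) (b * suc d)) (cong₂ ℤ._+_ (ℤ.pos-* a (suc e)) (ℤ.pos-* b (suc d)))

÷≤1 : ∀ {a} d .{{_ : NonZero d}} → a ≤ d → a ÷ d ℚᵘ.≤ 1ℚᵘ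
÷≤1 {a} (suc d) a≤d = *≤* (subst₂ ℤ._≤_ (sym (ℤ.*-identityʳ (+ a))) (sym (ℤ.*-identityˡ (+ suc d))) (ℤ.+≤+ a≤d))

toℚᵘ-/ : ∀ a d .{{_ : NonZero d}} → toℚᵘ (+ a / d) ≃ a ÷ d
toℚᵘ-/ a (suc d) = ℚ.toℚᵘ-fromℚᵘ (a ÷ suc d)

module _ (q u : ℕ) .{{_ : NonZero q}} where

  toℚᵘ-powℚ : ∀ k → toℚᵘ (powℚ (+ u / q) k) ≃ (u ^ k ÷ q ^ k) {{m^n≢0 q k}}
  toℚᵘ-powℚ zero    = ℚᵘ.≃-refl
  toℚᵘ-powℚ (suc k) = begin
    toℚᵘ (+ u / q *ℚ powℚ (+ u / q) k)          ≈⟨ ℚ.toℚᵘ-homo-* (+ u / q) (powℚ (+ u / q) k) ⟩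
    toℚᵘ (+ u / q) ℚᵘ.* toℚᵘ (powℚ (+ u / q) k) ≈⟨ ℚᵘ.*-cong (toℚᵘ-/ u q) (toℚᵘ-powℚ k) ⟩
    u ÷ q ℚᵘ.* (u ^ k ÷ q ^ k) {{q^k≢0}}       ≈⟨ ÷-* q (q ^ k) {{_}} {{q^k≢0}} ⟩
    (u ^ suc k ÷ q ^ suc k) {{m^n≢0 q (suc k)}} ∎
    where
    open ℚᵘ.≃-Reasoning
    q^k≢0 = m^n≢0 q k

  q^N*N!≢0 : ∀ N → NonZero (q ^ N * N !)
  q^N*N!≢0 N = m*n≢0 (q ^ N) (N !) {{m^n≢0 q N}} {{N !≢0}}

  toℚᵘ-expPartial : ∀ N → toℚᵘ (expPartial (+ u / q) N) ≃ (expScaled q N u ÷ (q ^ N * N !)) {{q^N*N!≢0 N}}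
  toℚᵘ-expPartial zero    = ℚᵘ.≃-refl
  toℚᵘ-expPartial (suc N) = begin
    toℚᵘ (expPartial y N +ℚ powℚ y (suc N) *ℚ 1/[N+1]!)
      ≈⟨ ℚ.toℚᵘ-homo-+ (expPartial y N) _ ⟩
    toℚᵘ (expPartial y N) ℚᵘ.+ toℚᵘ (powℚ y (suc N) *ℚ 1/[N+1]!)
      ≈⟨ ℚᵘ.+-cong (toℚᵘ-expPartial N) (ℚᵘ.≃-trans (ℚ.toℚᵘ-homo-* (powℚ y (suc N)) 1/[N+1]!)
                                                   (ℚᵘ.*-cong (toℚᵘ-powℚ (suc N)) (toℚᵘ-/ 1 (suc N !) {{suc N !≢0}}))) ⟩
    (E ÷ D) {{D≢0}} ℚᵘ.+ (u ^ suc N ÷ q ^ suc N) {{q^N+1≢0}} ℚᵘ.* (1 ÷ suc N !) {{suc N !≢0}}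
      ≈⟨ ℚᵘ.+-congʳ ((E ÷ D) {{D≢0}}) (÷-* (q ^ suc N) (suc N !) {{q^N+1≢0}} {{suc N !≢0}}) ⟩
    (E ÷ D) {{D≢0}} ℚᵘ.+ ((u ^ suc N * 1) ÷ D′) {{D′≢0}}
      ≈⟨ ÷-+ D D′ {{D≢0}} {{D′≢0}} ⟩
    ((E * D′ + u ^ suc N * 1 * D) ÷ (D * D′)) {{m*n≢0 D D′ {{D≢0}} {{D′≢0}}}}
      ≈⟨ ÷-≃ (D * D′) D′ {{m*n≢0 D D′ {{D≢0}} {{D′≢0}}}} {{D′≢0}}
             (common-denominator q N (q ^ N) (N !) E (u ^ suc N)) ⟩
    (expScaled q (suc N) u ÷ D′) {{D′≢0}}
      ∎
    where
    open ℚᵘ.≃-Reasoning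
    y = + u / q
    1/[N+1]! = _/_ (+ 1) (suc N !) {{suc N !≢0}}
    E = expScaled q N u
    D = q ^ N * N !
    D≢0 = q^N*N!≢0 N
    D′ = q ^ suc N * suc N !
    D′≢0 = q^N*N!≢0 (suc N)
    q^N+1≢0 = m^n≢0 q (suc N)
    common-denominator : ∀ q N p f E X →
      (E * ((q * p) * (suc N * f)) + X * 1 * (p * f)) * ((q * p) * (suc N * f))
        ≡ (q * suc N * E + X) * ((p * f) * ((q * p) * (suc N * f)))
    common-denominator = solve-∀

  *-expPartial≤1 : ∀ a d N .{{_ : NonZero d}} → a * expScaled q N u ≤ d * (q ^ N * N !) →
                   (+ a / d) *ℚ expPartial (+ u / q) N ℚ.≤ 1ℚ
  *-expPartial≤1 a d N {{d≢0}} bound = ℚ.toℚᵘ-cancel-≤ (begin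
    toℚᵘ ((+ a / d) *ℚ expPartial (+ u / q) N)               ≃⟨ ℚ.toℚᵘ-homo-* (+ a / d) (expPartial (+ u / q) N) ⟩
    toℚᵘ (+ a / d) ℚᵘ.* toℚᵘ (expPartial (+ u / q) N)        ≃⟨ ℚᵘ.*-cong (toℚᵘ-/ a d) (toℚᵘ-expPartial N) ⟩
    a ÷ d ℚᵘ.* (expScaled q N u ÷ (q ^ N * N !)) {{D≢0}}   ≃⟨ ÷-* d (q ^ N * N !) {{_}} {{D≢0}} ⟩
    ((a * expScaled q N u) ÷ (d * (q ^ N * N !))) {{dD≢0}} ≤⟨ ÷≤1 (d * (q ^ N * N !)) {{dD≢0}} bound ⟩
    1ℚᵘ                                                      ∎)
    where
    open ℚᵘ.≤-Reasoning
    D≢0 = q^N*N!≢0 N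
    dD≢0 = m*n≢0 d (q ^ N * N !) {{d≢0}} {{D≢0}}

survives : ∀ {m L} → Restriction m L → Term m L → Bool
survives ρ T = not (evalsToZero ρ T)

survivors : (m L : ℕ) → Term m L → ℕ
survivors m L T = countTrue (λ ρ → survives ρ T) (allRestrictions m L)

clashes : ∀ {L} → Fin L × Bool → Fin L × Bool → Bool
clashes (k′ , v) (k , b) = isYes (k′ ≟F k) ∧ not (isYes (v ≟B b))

mentions : ∀ {m L} → Term m L → Fin m → Bool
mentions []            i = false
mentions ((j , _) ∷ T) i = isYes (i ≟F j) ∨ mentions T i

mentionedCount : ∀ {m L} → Term m L → ℕ
mentionedCount {m} T = countTrue (mentions T) (allFin m)

tailTerm : ∀ {m L} → Term (suc m) L → Term m L
tailTerm []                 = []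
tailTerm ((zero  , _)  ∷ T) = tailTerm T
tailTerm ((suc i , kb) ∷ T) = (i , kb) ∷ tailTerm T

headSurvives : ∀ {m L} → Fin L × Bool → Term (suc m) L → Bool
headSurvives c []                 = true
headSurvives c ((zero  , kb) ∷ T) = not (clashes c kb) ∧ headSurvives c T
headSurvives c ((suc _ , _)  ∷ T) = headSurvives c T

headSurvivors : ∀ {m L} → Term (suc m) L → ℕ
headSurvivors {L = L} T = countTrue (λ c → headSurvives c T) (choices L)

survives-∷ : ∀ {m L} c (ρ : Restriction m L) (T : Term (suc m) L) →
  survives (c ∷ᵥ ρ) T ≡ headSurvives c T ∧ survives ρ (tailTerm T)
survives-∷ c ρ [] = refl
survives-∷ c ρ ((zero , kb) ∷ T) with clashes c kb
... | true  = refl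
... | false = survives-∷ c ρ T
survives-∷ c ρ ((suc i , kb) ∷ T) with falsifies ρ (i , kb)
... | true  = sym (∧-zeroʳ (headSurvives c T))
... | false = survives-∷ c ρ T

survivors-suc : ∀ {m L} (T : Term (suc m) L) →
  survivors (suc m) L T ≡ headSurvivors T * survivors m L (tailTerm T)
survivors-suc {m} {L} T =
  countTrue-concatMap _∷ᵥ_ (λ ρ → survives ρ T) (λ c → headSurvives c T) (λ ρ → survives ρ (tailTerm T))
    (λ c ρ → survives-∷ c ρ T) (choices L) (allRestrictions m L)

mentions-tailTerm : ∀ {m L} i (T : Term (suc m) L) → mentions T (suc i) ≡ mentions (tailTerm T) i
mentions-tailTerm i [] = refl
mentions-tailTerm i ((zero  , _) ∷ T) = mentions-tailTerm i T
mentions-tailTerm i ((suc j , _) ∷ T) with i ≟F j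
... | yes _ = refl
... | no  _ = mentions-tailTerm i T

mentionedCount-suc : ∀ {m L} (T : Term (suc m) L) →
  mentionedCount T ≡ (if mentions T zero then suc (mentionedCount (tailTerm T)) else mentionedCount (tailTerm T))
mentionedCount-suc {m} T = cong (λ K → if mentions T zero then suc K else K) (begin
    countTrue (mentions T) (tabulate suc)        ≡⟨ cong (countTrue (mentions T)) (map-tabulate id suc) ⟨
    countTrue (mentions T) (map suc (allFin m)) ≡⟨ countTrue-map (mentions T) suc (allFin m) ⟩
    countTrue (mentions T ∘ suc) (allFin m)     ≡⟨ countTrue-cong (λ i → mentions-tailTerm i T) (allFin m) ⟩
    mentionedCount (tailTerm T)                 ∎)
  where open ≡-Reasoning

length-choices : ∀ L → length (choices L) ≡ 2 * L
length-choices L = trans (pairs (allFin L)) (trans (cong (_* 2) (length-tabulate {n = L} id)) (*-comm L 2))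
  where
  pairs : ∀ {A : Set} (xs : List A) → length (cartesianProduct xs (true ∷ false ∷ [])) ≡ length xs * 2
  pairs []       = refl
  pairs (x ∷ xs) = cong (λ n → suc (suc n)) (pairs xs)

∈-choices : ∀ {L} (c : Fin L × Bool) → c ∈ choices L
∈-choices (k , true)  = ∈-cartesianProduct⁺ (∈-allFin k) (here refl)
∈-choices (k , false) = ∈-cartesianProduct⁺ (∈-allFin k) (there (here refl))

headSurvivors≤ : ∀ {m L} (T : Term (suc m) L) → headSurvivors T ≤ 2 * L
headSurvivors≤ {L = L} T = subst (headSurvivors T ≤_) (trans (countTrue-true (choices L)) (length-choices L))
  (countTrue-mono-≤ (λ _ _ → refl) (choices L))

falsifying-choice : ∀ {m L} (T : Term (suc m) L) → mentions T zero ≡ true → ∃ λ c → headSurvives c T ≡ false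
falsifying-choice ((zero , k , b) ∷ T) _ = (k , not b) , cong (λ x → not x ∧ headSurvives (k , not b) T) (clash k b)
  where
  clash : ∀ {L} (k : Fin L) b → clashes (k , not b) (k , b) ≡ true
  clash k true  rewrite isYes-refl k = refl
  clash k false rewrite isYes-refl k = refl
falsifying-choice ((suc _ , _) ∷ T) m₀ = falsifying-choice T m₀

headSurvivors< : ∀ {m L} (T : Term (suc m) L) → mentions T zero ≡ true → headSurvivors T < 2 * L
headSurvivors< {L = L} T m₀ with c , c-fails ← falsifying-choice T m₀ =
  subst (headSurvivors T <_) (trans (countTrue-true (choices L)) (length-choices L))
    (countTrue-mono-< (λ _ _ → refl) (choices L) (∈-choices c) c-fails refl)

module _ {L : ℕ} where

  private
    q r : ℕ
    q = 2 * L
    r = pred q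

  survivors-bound : ∀ m (T : Term m L) → survivors m L T * q ^ mentionedCount T ≤ q ^ m * r ^ mentionedCount T
  survivors-bound zero T with survives []ᵥ T
  ... | true  = ≤-refl
  ... | false = z≤n
  survivors-bound (suc m) T rewrite survivors-suc T | mentionedCount-suc T with mentions T zero in m₀
  ... | true = begin
      h * S * (q * q ^ K)     ≡⟨ [m*n]*[o*p]≡[m*o]*[n*p] h S q (q ^ K) ⟩
      h * q * (S * q ^ K)     ≤⟨ *-mono-≤ (*-monoˡ-≤ q h≤r) (survivors-bound m (tailTerm T)) ⟩
      r * q * (q ^ m * r ^ K) ≡⟨ cong (_* (q ^ m * r ^ K)) (*-comm r q) ⟩
      q * r * (q ^ m * r ^ K) ≡⟨ [m*n]*[o*p]≡[m*o]*[n*p] q r (q ^ m) (r ^ K) ⟩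
      q * q ^ m * (r * r ^ K) ∎
    where
    open ≤-Reasoning
    h = headSurvivors T
    S = survivors m L (tailTerm T)
    K = mentionedCount (tailTerm T)
    h≤r : h ≤ r
    h≤r = suc[m]≤n⇒m≤pred[n] (headSurvivors< T m₀)
  ... | false = begin
      h * S * q ^ K       ≡⟨ *-assoc h S (q ^ K) ⟩
      h * (S * q ^ K)     ≤⟨ *-mono-≤ (headSurvivors≤ T) (survivors-bound m (tailTerm T)) ⟩
      q * (q ^ m * r ^ K) ≡⟨ *-assoc q (q ^ m) (r ^ K) ⟨
      q * q ^ m * r ^ K   ∎
    where
    open ≤-Reasoning
    h = headSurvivors T
    S = survivors m L (tailTerm T)
    K = mentionedCount (tailTerm T)

mentions-own : ∀ {m L} (T : Term m L) → All (λ i → mentions T i ≡ true) (map proj₁ T)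
mentions-own []            = []
mentions-own ((i , _) ∷ T) = mentions-head ∷ All.map mentions-tail (mentions-own T)
  where
  mentions-head : isYes (i ≟F i) ∨ mentions T i ≡ true
  mentions-head rewrite isYes-refl i = refl
  mentions-tail : ∀ {j} → mentions T j ≡ true → isYes (j ≟F i) ∨ mentions T j ≡ true
  mentions-tail {j} mentioned rewrite mentioned = ∨-zeroʳ (isYes (j ≟F i))

pigeonsMentioned≤mentionedCount : ∀ {m L} (T : Term m L) → pigeonsMentioned T ≤ mentionedCount T
pigeonsMentioned≤mentionedCount T =
  unique⇒length≤countTrue (mentions T) _ (Unique.deduplicate-! _≟F_ (map proj₁ T)) (deduplicate⁺ _≟F_ (mentions-own T))

lemma5 : (n m L : ℕ) → n ≡ 2 ^ L → .{{_ : NonZero L}} → 1 ≤ m →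
    (T : Term m L) →
    probNotZero m L T ≤exp- (_/_ (+ pigeonsMentioned T) (2 * L) {{m*n≢0 2 L}})
lemma5 _ m L@(suc _) _ _ T N = *-expPartial≤1 q n′ S (q ^ m) N {{m^n≢0 q m}} survivors*expScaled≤
  where
  q  = 2 * L
  -- L is a successor, so suc r reduces to q, as expScaled-bound r requires.
  r  = pred q
  S  = survivors m L T
  n′ = pigeonsMentioned T
  K  = mentionedCount T
  survivors≤ratio^n′ : S * q ^ n′ ≤ q ^ m * r ^ n′
  survivors≤ratio^n′ = cross-≤-trans {S} {q ^ m} {r ^ K} {q ^ K} {r ^ n′} {q ^ n′} {{m^n≢0 q K}}
    (survivors-bound m T) (pow-ratio-antimono (pred[n]≤n {q}) (pigeonsMentioned≤mentionedCount T))
  survivors*expScaled≤ : S * expScaled q N n′ ≤ q ^ m * (q ^ N * N !)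
  survivors*expScaled≤ = cross-≤-trans {S} {q ^ m} {r ^ n′} {q ^ n′} {q ^ N * N !} {expScaled q N n′} {{m^n≢0 q n′}}
    survivors≤ratio^n′ (expScaled-bound r N n′)
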